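{- Let $R_1 \subsetneq S_1 \subseteq \{0,1,2\}^3$ be given by $S_1 = C_6 \times \{0,1,2\}$ and $R_1 = (C_6^{*} \times \{0,1,2\}) \cup (C_6 \times \{1,2\})$. There is a constant $C>0$ such that for all but finitely many $m$, there is a $3$-partite non-redundant instance $(V_1,V_2,V_3,E)$ of $\operatorname{CSP}(R_1 \mid S_1)$ with $|E| = m$ such that $|\pi_I E| \le C m^{3/4}$ for every $I \subsetneq [3]$ (i.e. it is $\Omega(m^{1/4})$-shrinking).
   Context: $C_6 = \{(0,0),(0,1),(1,0),(1,2),(2,1),(2,2)\}$ and $C_6^{*} = C_6\setminus\{(0,0)\}$; $R_1\mid S_1$ is the box product $(C_6^*\mid C_6)\boxtimes(\{1,2\}\mid\{0,1,2\})$. An $r$-partite instance is $(V_1,\dots,V_r,E)$ with $E\subseteq V_1\times\dots\times V_r$. For $P\subsetneq Q\subseteq D^r$ it is non-redundant for $\operatorname{CSP}(P\mid Q)$ if for every $e\in E$ there is $\psi_e:\bigsqcup V_i\to D$ with $\psi_e(e')\in P$ for all $e'\neq e$ and $\psi_e(e)\in Q\setminus P$. For $I\subseteq[r]$, $\pi_I E = \{(e_i : i \in I) : e\in E\}$. A hypergraph is $\lambda$-shrinking if $|\pi_I E|\le |E|/\lambda$ for all $I\subsetneq[r]$. -}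

module Defs where

open import Data.Bool using (Bool; true; false; _∧_; _∨_; not)
open import Data.Nat using (ℕ; _≤_; _^_; _*_)
open import Data.Fin using (Fin; zero; suc; toℕ)
open import Data.Product using (_×_; _,_; Σ; ∃)
open import Data.List using (List; []; _∷_; length; map; deduplicate)
import Data.List.Properties as LP
import Data.Nat.Properties as NP
open import Data.List.Membership.Propositional using (_∈_)
open import Relation.Binary.PropositionalEquality using (_≡_; _≢_)

D : Set
D = Fin 3

C6 : D → D → Bool
C6 zero zero = true
C6 zero (suc zero) = true
C6 (suc zero) zero = true
C6 (suc zero) (suc (suc zero)) = true
C6 (suc (suc zero)) (suc zero) = true
C6 (suc (suc zero)) (suc (suc zero)) = true
C6 _ _ = false

C6* : D → D → Bool
C6* zero zero = false
C6* a b = C6 a b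

nonzero : D → Bool
nonzero zero = false
nonzero _ = true

S1 : D × D × D → Bool
S1 (a , b , c) = C6 a b

R1 : D × D × D → Bool
R1 (a , b , c) = C6* a b ∨ (C6 a b ∧ nonzero c)

-- A 3-partite instance with parts V1 = Fin n1, V2 = Fin n2, V3 = Fin n3;
-- an edge is an element of V1 × V2 × V3.
Edge : ℕ → ℕ → ℕ → Set
Edge n1 n2 n3 = Fin n1 × Fin n2 × Fin n3

-- An assignment ψ : V1 ⊔ V2 ⊔ V3 → D, given by its three components.
Assignment : ℕ → ℕ → ℕ → Set
Assignment n1 n2 n3 = (Fin n1 → D) × (Fin n2 → D) × (Fin n3 → D)

apply : ∀ {n1 n2 n3} → Assignment n1 n2 n3 → Edge n1 n2 n3 → D × D × D
apply (f , g , h) (x , y , z) = (f x , g y , h z)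

NonRedundant : ∀ {n1 n2 n3} → List (Edge n1 n2 n3) → Set
NonRedundant {n1} {n2} {n3} E =
  ∀ e → e ∈ E → Σ (Assignment n1 n2 n3) λ ψ →
    (∀ e' → e' ∈ E → e' ≢ e → R1 (apply ψ e') ≡ true)
    × S1 (apply ψ e) ≡ true × R1 (apply ψ e) ≡ false

Subset3 : Set
Subset3 = Fin 3 → Bool

Proper : Subset3 → Set
Proper I = ∃ λ i → I i ≡ false

keep : Bool → ℕ → List ℕ → List ℕ
keep true x xs = x ∷ xs
keep false x xs = xs

proj : ∀ {n1 n2 n3} → Subset3 → Edge n1 n2 n3 → List ℕ
proj I (x , y , z) =
  keep (I zero) (toℕ x) (keep (I (suc zero)) (toℕ y) (keep (I (suc (suc zero))) (toℕ z) []))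

projSize : ∀ {n1 n2 n3} → Subset3 → List (Edge n1 n2 n3) → ℕ
projSize I E = length (deduplicate (LP.≡-dec NP._≟_) (map (proj I) E))

{-# OPTIONS --safe #-}
-- The instance is built from the point–line incidence graph of the affine plane over ℤ/qℤ
-- (q prime): E consists of m of the triples (x , ℓ , z) with x ∈ ℓ.  That graph has q³ flags
-- and no 4-cycle, and the absence of 4-cycles is exactly what lets an assignment separate each
-- edge from all the others (see witness).  Every projection onto two coordinates has at most q³
-- elements, so for q⁴ ≈ m the instance is Ω(m^(1/4))-shrinking.
--
-- To have q⁴ within a constant factor of every large m one needs a prime in each interval
-- (x, 64x].  This is a Chebyshev-type estimate via Nair's bound: 2ⁿ ≤ (2n+1)·C(2n,n) divides
-- every common multiple of 1, …, 2n+1, while without primes in (W, 2n+1] such a common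
-- multiple is (s!)^T · primorial W with s² > 2n+1 and 2^T > 2n+1, which is too small
-- because primorial W ≤ 8^W.
module Submission where

open import Defs
open import Data.Bool using (true; false)
open import Data.Empty using (⊥-elim)
open import Data.Fin as Fin using (Fin; zero; suc; toℕ; combine; remQuot)
open import Data.Fin.Properties
  using (toℕ<n; toℕ-injective; toℕ-fromℕ<; combine-remQuot; remQuot-combine; combine-injectiveˡ)
open import Data.List
  using (List; []; _∷_; _++_; length; map; take; allFin; cartesianProduct; cartesianProductWith; deduplicate)
import Data.List.Properties as LP
open import Data.List.Properties using (length-++; length-map; length-tabulate; length-take)
open import Data.List.Membership.Propositional using (_∈_)
open import Data.List.Membership.Propositional.Properties
  using ( ∈-∃++; ∈-++⁻; ∈-++⁺ˡ; ∈-++⁺ʳ; ∈-map⁺; ∈-map⁻; ∈-allFin; ∈-cartesianProduct⁺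
        ; ∈-cartesianProductWith⁻; ∈-deduplicate⁻)
open import Data.List.Relation.Binary.Subset.Propositional using (_⊆_)
open import Data.List.Relation.Unary.All as All using (All; []; _∷_; lookup)
import Data.List.Relation.Unary.All.Properties as All
open import Data.List.Relation.Unary.AllPairs using (_∷_)
open import Data.List.Relation.Unary.Any using (here; there)
open import Data.List.Relation.Unary.Unique.Propositional using (Unique)
open import Data.List.Relation.Unary.Unique.Propositional.Properties using (cartesianProductWith⁺; allFin⁺; take⁺)
open import Data.Nat
  using (ℕ; zero; suc; _+_; _*_; _∸_; _^_; _!; _≤_; _<_; s≤s; z≤n; NonZero; >-nonZero
        ; _≤?_; _<?_; ⌊_/2⌋; ⌈_/2⌉; _%_; _/_)
open import Data.Nat.Divisibility
open import Data.Nat.DivMod using (m≡m%n+[m/n]*n; %-distribˡ-+; _mod_)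
open import Data.Nat.Induction using (<-rec)
open import Data.Nat.ListAction using (product)
open import Data.Nat.Primality using (Prime; prime?; euclidsLemma; prime⇒irreducible; prime⇒nonZero)
open import Data.Nat.Primality.Factorisation using (PrimeFactorisation; factorise)
open import Data.Nat.Properties
open import Data.List.Relation.Unary.Unique.DecPropositional.Properties (LP.≡-dec _≟_) using (deduplicate-!)
open import Data.Nat.Tactic.RingSolver using (solve-∀)
open import Data.Product using (_×_; Σ; ∃; _,_; proj₁; proj₂; uncurry)
open import Data.Sum as Sum using (_⊎_; inj₁; inj₂; [_,_]′)
open import Data.Unit using (tt)
open import Function using (_∘_; id; case_of_)
open import Relation.Binary.Definitions using (Decidable)
open import Relation.Binary.PropositionalEquality
open import Relation.Nullary using (¬_; Dec; yes; no)
open import Relation.Nullary.Decidable using (decidable-stable; _×-dec_)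

-- Binomial coefficients

-- binom a b = (a + b choose a)
binom : ℕ → ℕ → ℕ
binom zero    b       = 1
binom (suc a) zero    = 1
binom (suc a) (suc b) = binom a (suc b) + binom (suc a) b

binom*a!*b!≡[a+b]! : ∀ a b → binom a b * (a ! * b !) ≡ (a + b) !
binom*a!*b!≡[a+b]! zero    b       = trans (*-identityˡ _) (*-identityˡ _)
binom*a!*b!≡[a+b]! (suc a) zero    =
  trans (*-identityˡ _) (trans (*-identityʳ _) (cong _! (sym (+-identityʳ (suc a)))))
binom*a!*b!≡[a+b]! (suc a) (suc b) = begin
  (X + Y) * (suc a ! * suc b !)
    ≡⟨ regroup X Y a b (a !) (b !) ⟩
  suc a * (X * (a ! * suc b !)) + suc b * (Y * (suc a ! * b !))
    ≡⟨ cong₂ (λ u v → suc a * u + suc b * v) (binom*a!*b!≡[a+b]! a (suc b)) Y*[1+a]!*b!≡F ⟩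
  suc a * F + suc b * F
    ≡⟨ *-distribʳ-+ F (suc a) (suc b) ⟨
  (suc a + suc b) !
    ∎
  where
  open ≡-Reasoning
  X = binom a (suc b)
  Y = binom (suc a) b
  F = (a + suc b) !
  Y*[1+a]!*b!≡F : Y * (suc a ! * b !) ≡ F
  Y*[1+a]!*b!≡F = trans (binom*a!*b!≡[a+b]! (suc a) b) (cong _! (sym (+-suc a b)))
  regroup : ∀ X Y a b u v → (X + Y) * ((suc a * u) * (suc b * v))
                          ≡ suc a * (X * (u * (suc b * v))) + suc b * (Y * ((suc a * u) * v))
  regroup = solve-∀

cancel-a!*b! : ∀ {x y} a b → x * (a ! * b !) ≡ y * (a ! * b !) → x ≡ y
cancel-a!*b! {x} {y} a b = *-cancelʳ-≡ x y (a ! * b !) {{a !* b !≢0}}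

binom-absorbˡ : ∀ a b → suc a * binom (suc a) b ≡ suc (a + b) * binom a b
binom-absorbˡ a b = cancel-a!*b! a b (begin
  suc a * binom (suc a) b * (a ! * b !)  ≡⟨ regroup (suc a) (binom (suc a) b) (a !) (b !) ⟩
  binom (suc a) b * (suc a ! * b !)      ≡⟨ binom*a!*b!≡[a+b]! (suc a) b ⟩
  suc (a + b) * (a + b) !                ≡⟨ cong (suc (a + b) *_) (binom*a!*b!≡[a+b]! a b) ⟨
  suc (a + b) * (binom a b * (a ! * b !)) ≡⟨ *-assoc (suc (a + b)) (binom a b) _ ⟨
  suc (a + b) * binom a b * (a ! * b !)  ∎)
  where
  open ≡-Reasoning
  regroup : ∀ c x u v → c * x * (u * v) ≡ x * ((c * u) * v)
  regroup = solve-∀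

binom-absorbʳ : ∀ a b → suc b * binom a (suc b) ≡ suc (a + b) * binom a b
binom-absorbʳ a b = cancel-a!*b! a b (begin
  suc b * binom a (suc b) * (a ! * b !)  ≡⟨ regroup (suc b) (binom a (suc b)) (a !) (b !) ⟩
  binom a (suc b) * (a ! * suc b !)      ≡⟨ binom*a!*b!≡[a+b]! a (suc b) ⟩
  (a + suc b) !                          ≡⟨ cong _! (+-suc a b) ⟩
  suc (a + b) * (a + b) !                ≡⟨ cong (suc (a + b) *_) (binom*a!*b!≡[a+b]! a b) ⟨
  suc (a + b) * (binom a b * (a ! * b !)) ≡⟨ *-assoc (suc (a + b)) (binom a b) _ ⟨
  suc (a + b) * binom a b * (a ! * b !)  ∎)
  where
  open ≡-Reasoning
  regroup : ∀ c x u v → c * x * (u * v) ≡ x * (u * (c * v))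
  regroup = solve-∀

binom>0 : ∀ a b → 0 < binom a b
binom>0 zero    b       = s≤s z≤n
binom>0 (suc a) zero    = s≤s z≤n
binom>0 (suc a) (suc b) = ≤-trans (binom>0 a (suc b)) (m≤m+n _ _)

binom≤2^[a+b] : ∀ a b → binom a b ≤ 2 ^ (a + b)
binom≤2^[a+b] zero    b       = m^n>0 2 b
binom≤2^[a+b] (suc a) zero    = m^n>0 2 (suc a + 0)
binom≤2^[a+b] (suc a) (suc b) = begin
  binom a (suc b) + binom (suc a) b
    ≤⟨ +-mono-≤ (binom≤2^[a+b] a (suc b)) (binom≤2^[a+b] (suc a) b) ⟩
  2 ^ (a + suc b) + 2 ^ (suc a + b)      ≡⟨ cong (λ k → 2 ^ k + 2 ^ (suc a + b)) (+-suc a b) ⟩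
  2 ^ (suc a + b) + 2 ^ (suc a + b)      ≡⟨ cong (2 ^ (suc a + b) +_) (+-identityʳ _) ⟨
  2 ^ suc (suc a + b)                    ≡⟨ cong (λ k → 2 ^ suc k) (+-suc a b) ⟨
  2 ^ (suc a + suc b)                    ∎
  where open ≤-Reasoning

binom-monoˡ : ∀ a b → binom a b ≤ binom (suc a) b
binom-monoˡ zero    zero    = ≤-refl
binom-monoˡ (suc a) zero    = ≤-refl
binom-monoˡ a       (suc b) = m≤m+n (binom a (suc b)) (binom (suc a) b)

binom-monoʳ : ∀ a b → binom a b ≤ binom a (suc b)
binom-monoʳ zero    b = ≤-refl
binom-monoʳ (suc a) b = m≤n+m (binom (suc a) b) (binom a (suc b))

2^n≤binom[n,n] : ∀ n → 2 ^ n ≤ binom n n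
2^n≤binom[n,n] zero    = ≤-refl
2^n≤binom[n,n] (suc n) = begin
  2 ^ n + (2 ^ n + 0)                ≡⟨ cong (2 ^ n +_) (+-identityʳ _) ⟩
  2 ^ n + 2 ^ n                      ≤⟨ +-mono-≤ (≤-trans (2^n≤binom[n,n] n) (binom-monoʳ n n))
                                                 (≤-trans (2^n≤binom[n,n] n) (binom-monoˡ n n)) ⟩
  binom n (suc n) + binom (suc n) n  ∎
  where open ≤-Reasoning

-- c * y ≡ c * x + x * y says 1/c = 1/x − 1/y, whence c * (K/x − K/y) = K.
∣-reciprocal-difference : ∀ {x y c K} → 0 < y → c * y ≡ c * x + x * y → x ∣ K → y ∣ K → c ∣ K
∣-reciprocal-difference {x} {y} {c} {K} y>0 cy≡cx+xy (divides α K≡αx) (divides β K≡βy) =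
  divides (α ∸ β) (*-cancelʳ-≡ K ((α ∸ β) * c) y {{>-nonZero y>0}} (begin
    K * y                          ≡⟨ *-comm K y ⟩
    y * K                          ≡⟨ m+n∸m≡n (c * β * y) (y * K) ⟨
    c * β * y + y * K ∸ c * β * y  ≡⟨ cong (_∸ c * β * y) cαy≡cβy+yK ⟨
    c * α * y ∸ c * β * y          ≡⟨ *-distribʳ-∸ y (c * α) (c * β) ⟨
    (c * α ∸ c * β) * y            ≡⟨ cong (_* y) (*-distribˡ-∸ c α β) ⟨
    c * (α ∸ β) * y                ≡⟨ cong (_* y) (*-comm c (α ∸ β)) ⟩
    (α ∸ β) * c * y                ∎))
  where
  open ≡-Reasoning
  cαy≡cβy+yK : c * α * y ≡ c * β * y + y * K
  cαy≡cβy+yK = begin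
    c * α * y                 ≡⟨ *-assoc c α y ⟩
    c * (α * y)               ≡⟨ cong (c *_) (*-comm α y) ⟩
    c * (y * α)               ≡⟨ *-assoc c y α ⟨
    c * y * α                 ≡⟨ cong (_* α) cy≡cx+xy ⟩
    (c * x + x * y) * α       ≡⟨ regroup c x y α ⟩
    c * (α * x) + y * (α * x) ≡⟨ cong₂ (λ u v → c * u + y * v) K≡αx K≡αx ⟨
    c * K + y * K             ≡⟨ cong (λ u → c * u + y * K) K≡βy ⟩
    c * (β * y) + y * K       ≡⟨ cong (_+ y * K) (*-assoc c β y) ⟨
    c * β * y + y * K         ∎
    where
    regroup : ∀ c x y α → (c * x + x * y) * α ≡ c * (α * x) + y * (α * x)
    regroup = solve-∀

-- Nair: with H a b = (1 + a + b) * binom a b one has 1/H (1+a) b = 1/H a b − 1/H a (1+b).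
[1+a+b]*binom∣ : ∀ a b {K} → (∀ i → 0 < i → i ≤ suc (a + b) → i ∣ K) →
                 suc (a + b) * binom a b ∣ K
[1+a+b]*binom∣ zero    b {K} ∣K =
  subst (_∣ K) (sym (*-identityʳ (suc b))) (∣K (suc b) (s≤s z≤n) ≤-refl)
[1+a+b]*binom∣ (suc a) b {K} ∣K =
  ∣-reciprocal-difference (*-mono-≤ (s≤s (z≤n {a + suc b})) (binom>0 a (suc b))) reciprocal-identity
    ([1+a+b]*binom∣ a b (λ i i>0 i≤ → ∣K i i>0 (m≤n⇒m≤1+n i≤)))
    ([1+a+b]*binom∣ a (suc b) (λ i i>0 i≤ → ∣K i i>0 (subst (i ≤_) (cong suc (+-suc a b)) i≤)))
  where
  open ≡-Reasoning
  n₁ = suc (a + b)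
  n₂ = suc (suc (a + b))
  u = binom (suc a) b
  v = binom a (suc b)
  w = binom a b
  reciprocal-identity : n₂ * u * (suc (a + suc b) * v)
                      ≡ n₂ * u * (n₁ * w) + n₁ * w * (suc (a + suc b) * v)
  reciprocal-identity rewrite +-suc a b = begin
    n₂ * u * (n₂ * v)                                ≡⟨ split-n₂ a b u v ⟩
    n₂ * u * (suc b * v) + suc a * u * (n₂ * v)      ≡⟨ cong₂ (λ s t → n₂ * u * s + t * (n₂ * v))
                                                             (binom-absorbʳ a b) (binom-absorbˡ a b) ⟩
    n₂ * u * (n₁ * w) + n₁ * w * (n₂ * v)            ∎
    where
    split-n₂ : ∀ a b u v → suc (suc (a + b)) * u * (suc (suc (a + b)) * v)
             ≡ suc (suc (a + b)) * u * (suc b * v) + suc a * u * (suc (suc (a + b)) * v)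
    split-n₂ = solve-∀

-- Primes in an interval

prime>1 : ∀ {p} → Prime p → 1 < p
prime>1 {suc (suc _)} _ = s≤s (s≤s z≤n)

prime∣n!⇒≤ : ∀ {p} n → Prime p → p ∣ n ! → p ≤ n
prime∣n!⇒≤ zero    pr p∣1 = ⊥-elim (>⇒∤ (prime>1 pr) p∣1)
prime∣n!⇒≤ (suc n) pr p∣n! with euclidsLemma (suc n) (n !) pr p∣n!
... | inj₁ p∣1+n = ∣⇒≤ p∣1+n
... | inj₂ p∣n!  = m≤n⇒m≤1+n (prime∣n!⇒≤ n pr p∣n!)

≤⇒∣! : ∀ {p n} → 0 < p → p ≤ n → p ∣ n !
≤⇒∣! {suc p} _ p≤n = ∣-trans (m∣m*n (p !)) (m≤n⇒m!∣n! p≤n)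

prime∤⇒*∣ : ∀ {p d M} → Prime p → ¬ p ∣ d → d ∣ M → p ∣ M → d * p ∣ M
prime∤⇒*∣ {p} {d} pr p∤d (divides t refl) p∣td with euclidsLemma t d pr p∣td
... | inj₂ p∣d = ⊥-elim (p∤d p∣d)
... | inj₁ (divides s refl) = divides s (trans (*-assoc s p d) (cong (s *_) (*-comm p d)))

prime∣binom : ∀ {a b p} → b ≤ a → a < p → p ≤ a + b → Prime p → p ∣ binom a b
prime∣binom {a} {b} {p} b≤a a<p p≤a+b pr
  with euclidsLemma (binom a b) (a ! * b !) pr
         (subst (p ∣_) (sym (binom*a!*b!≡[a+b]! a b)) (≤⇒∣! (≤-trans (s≤s z≤n) a<p) p≤a+b))
... | inj₁ p∣binom = p∣binom
... | inj₂ p∣a!*b! with euclidsLemma (a !) (b !) pr p∣a!*b!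
...   | inj₁ p∣a! = ⊥-elim (<⇒≱ a<p (prime∣n!⇒≤ a pr p∣a!))
...   | inj₂ p∣b! = ⊥-elim (<⇒≱ a<p (≤-trans (prime∣n!⇒≤ b pr p∣b!) b≤a))

primorial : ℕ → ℕ
primorial zero = 1
primorial (suc n) with prime? (suc n)
... | yes _ = primorial n * suc n
... | no  _ = primorial n

primorial>0 : ∀ n → 0 < primorial n
primorial>0 zero = s≤s z≤n
primorial>0 (suc n) with prime? (suc n)
... | yes _ = *-mono-≤ (primorial>0 n) (s≤s z≤n)
... | no  _ = primorial>0 n

prime∣primorial : ∀ {p} n → Prime p → p ≤ n → p ∣ primorial n
prime∣primorial zero pr p≤0 = ⊥-elim (<⇒≱ (prime>1 pr) (≤-trans p≤0 z≤n))
prime∣primorial {p} (suc n) pr p≤1+n with m≤n⇒m<n∨m≡n p≤1+n | prime? (suc n)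
... | inj₁ p<1+n | yes _   = ∣-trans (prime∣primorial n pr (≤-pred p<1+n)) (m∣m*n (suc n))
... | inj₁ p<1+n | no  _   = prime∣primorial n pr (≤-pred p<1+n)
... | inj₂ refl  | yes _   = n∣m*n (primorial n)
... | inj₂ refl  | no  ¬pr = ⊥-elim (¬pr pr)

prime∣primorial⇒≤ : ∀ {p} n → Prime p → p ∣ primorial n → p ≤ n
prime∣primorial⇒≤ zero pr p∣1 = ⊥-elim (>⇒∤ (prime>1 pr) p∣1)
prime∣primorial⇒≤ (suc n) pr p∣ with prime? (suc n)
... | no  _ = m≤n⇒m≤1+n (prime∣primorial⇒≤ n pr p∣)
... | yes _ with euclidsLemma (primorial n) (suc n) pr p∣
...   | inj₁ p∣primorial = m≤n⇒m≤1+n (prime∣primorial⇒≤ n pr p∣primorial)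
...   | inj₂ p∣1+n       = ∣⇒≤ p∣1+n

primorial[a+b]∣primorial[a]*X : ∀ a b {X} → (∀ p → a < p → p ≤ a + b → Prime p → p ∣ X) →
                                primorial (a + b) ∣ primorial a * X
primorial[a+b]∣primorial[a]*X a zero {X} _ =
  subst (λ n → primorial n ∣ primorial a * X) (sym (+-identityʳ a)) (m∣m*n X)
primorial[a+b]∣primorial[a]*X a (suc b) {X} p∣X
  rewrite +-suc a b with prime? (suc (a + b))
... | yes pr = prime∤⇒*∣ pr (λ p∣ → <-irrefl refl (prime∣primorial⇒≤ (a + b) pr p∣)) ih
                 (∣-trans (p∣X (suc (a + b)) (s≤s (m≤m+n a b)) ≤-refl pr) (n∣m*n (primorial a)))
  where
  ih = primorial[a+b]∣primorial[a]*X a b (λ p a<p p≤a+b → p∣X p a<p (m≤n⇒m≤1+n p≤a+b))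
... | no _   = primorial[a+b]∣primorial[a]*X a b (λ p a<p p≤a+b → p∣X p a<p (m≤n⇒m≤1+n p≤a+b))

primorial[a+b]≤primorial[a]*2^[a+b] : ∀ {a b} → b ≤ a → primorial (a + b) ≤ primorial a * 2 ^ (a + b)
primorial[a+b]≤primorial[a]*2^[a+b] {a} {b} b≤a = begin
  primorial (a + b)          ≤⟨ ∣⇒≤ {{>-nonZero (*-mono-≤ (primorial>0 a) (binom>0 a b))}}
                                   (primorial[a+b]∣primorial[a]*X a b (λ p → prime∣binom b≤a)) ⟩
  primorial a * binom a b    ≤⟨ *-monoʳ-≤ (primorial a) (binom≤2^[a+b] a b) ⟩
  primorial a * 2 ^ (a + b)  ∎
  where open ≤-Reasoning

3*⌈[2+n]/2⌉≤2*[2+n] : ∀ n → 3 * ⌈ 2 + n /2⌉ ≤ 2 * (2 + n)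
3*⌈[2+n]/2⌉≤2*[2+n] zero          = ≤ᵇ⇒≤ 3 4 tt
3*⌈[2+n]/2⌉≤2*[2+n] (suc zero)    = ≤-refl
3*⌈[2+n]/2⌉≤2*[2+n] (suc (suc n)) = begin
  3 * suc ⌈ 2 + n /2⌉      ≡⟨ *-suc 3 ⌈ 2 + n /2⌉ ⟩
  3 + 3 * ⌈ 2 + n /2⌉      ≤⟨ +-mono-≤ (≤ᵇ⇒≤ 3 4 tt) (3*⌈[2+n]/2⌉≤2*[2+n] n) ⟩
  4 + 2 * (2 + n)          ≡⟨ *-distribˡ-+ 2 2 (2 + n) ⟨
  2 * (4 + n)              ∎
  where open ≤-Reasoning

primorial≤2^[3n] : ∀ n → primorial n ≤ 2 ^ (3 * n)
primorial≤2^[3n] = <-rec _ bound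
  where
  bound : ∀ n → (∀ {m} → m < n → primorial m ≤ 2 ^ (3 * m)) → primorial n ≤ 2 ^ (3 * n)
  bound zero          _  = ≤-refl
  bound (suc zero)    _  = m^n>0 2 3
  bound n@(suc (suc k)) ih = begin
    primorial n                ≡⟨ cong primorial a+b≡n ⟨
    primorial (a + b)          ≤⟨ primorial[a+b]≤primorial[a]*2^[a+b] (⌊n/2⌋≤⌈n/2⌉ n) ⟩
    primorial a * 2 ^ (a + b)  ≤⟨ *-monoˡ-≤ (2 ^ (a + b)) (ih (⌈n/2⌉<n k)) ⟩
    2 ^ (3 * a) * 2 ^ (a + b)  ≡⟨ ^-distribˡ-+-* 2 (3 * a) (a + b) ⟨
    2 ^ (3 * a + (a + b))      ≤⟨ ^-monoʳ-≤ 2 (≤-trans (≤-reflexive (cong (3 * a +_) a+b≡n))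
                                                         (+-monoˡ-≤ n (3*⌈[2+n]/2⌉≤2*[2+n] k))) ⟩
    2 ^ (2 * n + n)            ≡⟨ cong (2 ^_) (2n+n≡3n n) ⟩
    2 ^ (3 * n)                ∎
    where
    open ≤-Reasoning
    a = ⌈ n /2⌉
    b = ⌊ n /2⌋
    a+b≡n : a + b ≡ n
    a+b≡n = trans (+-comm a b) (⌊n/2⌋+⌈n/2⌉≡n n)
    2n+n≡3n : ∀ n → 2 * n + n ≡ 3 * n
    2n+n≡3n = solve-∀

^-monoˡ-∣ : ∀ {a b} n → a ∣ b → a ^ n ∣ b ^ n
^-monoˡ-∣ zero    _   = ∣-refl
^-monoˡ-∣ (suc n) a∣b = *-pres-∣ a∣b (^-monoˡ-∣ n a∣b)

^-monoʳ-∣ : ∀ p {m n} → m ≤ n → p ^ m ∣ p ^ n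
^-monoʳ-∣ p z≤n       = 1∣ _
^-monoʳ-∣ p (s≤s m≤n) = *-monoʳ-∣ p (^-monoʳ-∣ p m≤n)

prime∣prime⇒≡ : ∀ {p q} → Prime p → Prime q → p ∣ q → p ≡ q
prime∣prime⇒≡ pr qr p∣q with prime⇒irreducible qr p∣q
... | inj₁ refl = ⊥-elim (<-irrefl refl (prime>1 pr))
... | inj₂ p≡q  = p≡q

prime^e∣t*q⇒prime^e∣t : ∀ {p q t} e → Prime p → Prime q → p ≢ q → p ^ e ∣ t * q → p ^ e ∣ t
prime^e∣t*q⇒prime^e∣t {t = t} zero pr qr p≢q _ = 1∣ t
prime^e∣t*q⇒prime^e∣t {p} {q} {t} (suc e) pr qr p≢q p^[1+e]∣tq
  with euclidsLemma t q pr (∣-trans (m∣m*n (p ^ e)) p^[1+e]∣tq)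
... | inj₂ p∣q = ⊥-elim (p≢q (prime∣prime⇒≡ pr qr p∣q))
... | inj₁ (divides t′ refl) = subst (p ^ suc e ∣_) (*-comm p t′) (*-monoʳ-∣ p p^e∣t′)
  where
  p^e∣t′ : p ^ e ∣ t′
  p^e∣t′ = prime^e∣t*q⇒prime^e∣t e pr qr p≢q
             (*-cancelˡ-∣ p {{prime⇒nonZero pr}} (subst (p ^ suc e ∣_) (regroup t′ p q) p^[1+e]∣tq))
    where
    regroup : ∀ t′ p q → t′ * p * q ≡ p * (t′ * q)
    regroup = solve-∀

product∣ : ∀ {M} as → All Prime as → (∀ p e → Prime p → p ^ e ∣ product as → p ^ e ∣ M) →
           product as ∣ M
product∣ []       _          _    = 1∣ _
product∣ {M} (q ∷ as) (qr ∷ asr) ∣M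
  with subst (_∣ M) (*-identityʳ q) (∣M q 1 qr (subst (_∣ q * product as) q≡q^1 (m∣m*n (product as))))
  where q≡q^1 = sym (*-identityʳ q)
... | divides t refl = subst (q * product as ∣_) (*-comm q t) (*-monoʳ-∣ q (product∣ as asr ∣t))
  where
  ∣t : ∀ p e → Prime p → p ^ e ∣ product as → p ^ e ∣ t
  ∣t p e pr p^e∣ with p ≟ q
  ... | yes refl = *-cancelˡ-∣ p {{prime⇒nonZero pr}}
                     (subst (p * p ^ e ∣_) (*-comm t p) (∣M p (suc e) pr (*-monoʳ-∣ p p^e∣)))
  ... | no  p≢q  = prime^e∣t*q⇒prime^e∣t e pr qr p≢q (∣M p e pr (∣-trans p^e∣ (n∣m*n q)))

∣-by-prime-powers : ∀ {n M} .{{_ : NonZero n}} → (∀ p e → Prime p → p ^ e ∣ n → p ^ e ∣ M) → n ∣ M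
∣-by-prime-powers {n} {M} ∣M =
  subst (_∣ M) (sym n≡∏) (product∣ factors factorsPrime λ p e pr → ∣M p e pr ∘ subst (p ^ e ∣_) (sym n≡∏))
  where
  f = factorise n
  open PrimeFactorisation f using (factors; factorsPrime) renaming (isFactorisation to n≡∏)

-- Without primes in (W, N], a prime power p ^ e ≤ N has p ≤ s and e < T, or e ≤ 1 and p ≤ W.
module _ {W N s T : ℕ} (no-prime : ∀ p → W < p → p ≤ N → ¬ Prime p) (N<s*s : N < s * s) (N<2^T : N < 2 ^ T)
  where

  ∣s!^T*primorial : ∀ i → 0 < i → i ≤ N → i ∣ (s !) ^ T * primorial W
  ∣s!^T*primorial i i>0 i≤N = ∣-by-prime-powers {{>-nonZero i>0}} prime-power∣
    where
    prime-power∣ : ∀ p e → Prime p → p ^ e ∣ i → p ^ e ∣ (s !) ^ T * primorial W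
    prime-power∣ p zero    _  _        = 1∣ _
    prime-power∣ p (suc e) pr p^[1+e]∣i with p ≤? s
    ... | yes p≤s =
      ∣-trans (^-monoʳ-∣ p 1+e≤T) (∣-trans (^-monoˡ-∣ T (≤⇒∣! (<⇒≤ (prime>1 pr)) p≤s)) (m∣m*n _))
      where
      1+e≤T : suc e ≤ T
      1+e≤T = ≮⇒≥ λ T<1+e → <⇒≱ (begin-strict
        p ^ T         ≤⟨ ^-monoʳ-≤ p {{prime⇒nonZero pr}} (<⇒≤ T<1+e) ⟩
        p ^ suc e     ≤⟨ ∣⇒≤ {{>-nonZero i>0}} p^[1+e]∣i ⟩
        i             ≤⟨ i≤N ⟩
        N             <⟨ N<2^T ⟩
        2 ^ T         ∎) (^-monoˡ-≤ T (prime>1 pr))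
        where open ≤-Reasoning
    ... | no p≰s with e
    ...   | zero   =
      ∣-trans (∣-reflexive (*-identityʳ p)) (∣-trans (prime∣primorial W pr p≤W) (n∣m*n ((s !) ^ T)))
      where
      p≤N : p ≤ N
      p≤N = ≤-trans (∣⇒≤ {{>-nonZero i>0}} (∣-trans (m∣m*n (p ^ 0)) p^[1+e]∣i)) i≤N
      p≤W : p ≤ W
      p≤W = ≮⇒≥ λ W<p → no-prime p W<p p≤N pr
    ...   | suc e′ = ⊥-elim (<-irrefl refl (begin-strict
        N             <⟨ N<s*s ⟩
        s * s         ≤⟨ *-mono-≤ (<⇒≤ (≰⇒> p≰s)) (<⇒≤ (≰⇒> p≰s)) ⟩
        p * p         ≤⟨ *-monoʳ-≤ p (m≤m*n p (p ^ e′) {{m^n≢0 p e′ {{prime⇒nonZero pr}}}}) ⟩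
        p ^ suc (suc e′) ≤⟨ ∣⇒≤ {{>-nonZero i>0}} p^[1+e]∣i ⟩
        i             ≤⟨ i≤N ⟩
        N             ∎))
      where open ≤-Reasoning

n!≤n^n : ∀ n → n ! ≤ n ^ n
n!≤n^n zero    = ≤-refl
n!≤n^n (suc n) = *-monoʳ-≤ (suc n) (≤-trans (n!≤n^n n) (^-monoˡ-≤ n (n≤1+n n)))

[k+13]²≤2^[k+8] : ∀ k → (k + 13) * (k + 13) ≤ 2 ^ (k + 8)
[k+13]²≤2^[k+8] zero    = ≤ᵇ⇒≤ 169 256 tt
[k+13]²≤2^[k+8] (suc k) = begin
  (suc k + 13) * (suc k + 13)                          ≤⟨ m≤m+n _ (k * k + 24 * k + 142) ⟩
  (suc k + 13) * (suc k + 13) + (k * k + 24 * k + 142) ≡⟨ expand k ⟩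
  2 * ((k + 13) * (k + 13))                            ≤⟨ *-monoʳ-≤ 2 ([k+13]²≤2^[k+8] k) ⟩
  2 * 2 ^ (k + 8)                                      ∎
  where
  open ≤-Reasoning
  expand : ∀ k → (suc k + 13) * (suc k + 13) + (k * k + 24 * k + 142) ≡ 2 * ((k + 13) * (k + 13))
  expand = solve-∀

-- The Chebyshev argument with N = 2n + 1 < s * s = 2 ^ T = Q = 4n and W = n / 16.
module _ (k : ℕ) where

  private
    W n N Q s T : ℕ
    W = 2 ^ (2 * k + 20)
    n = 2 ^ (2 * k + 24)
    N = suc (n + n)
    Q = 2 ^ (2 * k + 26)
    s = 2 ^ (k + 13)
    T = 2 * (k + 13)

    N<Q : N < Q
    N<Q = begin-strict
      suc (n + n)               <⟨ +-monoˡ-< (n + n) (+-mono-≤ n>0 n>0) ⟩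
      n + n + (n + n)           ≡⟨ four n ⟩
      4 * n                     ≡⟨ ^-distribˡ-+-* 2 2 (2 * k + 24) ⟨
      2 ^ (2 + (2 * k + 24))    ≡⟨ cong (2 ^_) (exponent k) ⟩
      Q                         ∎
      where
      open ≤-Reasoning
      n>0 = m^n>0 2 (2 * k + 24)
      four : ∀ n → n + n + (n + n) ≡ 4 * n
      four = solve-∀
      exponent : ∀ k → 2 + (2 * k + 24) ≡ 2 * k + 26
      exponent = solve-∀

    s*s≡Q : s * s ≡ Q
    s*s≡Q = trans (sym (^-distribˡ-+-* 2 (k + 13) (k + 13))) (cong (2 ^_) (exponent k))
      where
      exponent : ∀ k → k + 13 + (k + 13) ≡ 2 * k + 26
      exponent = solve-∀

    2^T≡Q : 2 ^ T ≡ Q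
    2^T≡Q = cong (2 ^_) (exponent k)
      where
      exponent : ∀ k → 2 * (k + 13) ≡ 2 * k + 26
      exponent = solve-∀

    s!^T*primorial[W]<2^n : (s !) ^ T * primorial W < 2 ^ n
    s!^T*primorial[W]<2^n = begin-strict
      (s !) ^ T * primorial W           ≤⟨ *-mono-≤ (^-monoˡ-≤ T (n!≤n^n s)) (primorial≤2^[3n] W) ⟩
      (s ^ s) ^ T * 2 ^ (3 * W)         ≡⟨ cong (_* 2 ^ (3 * W)) (^-*-assoc s s T) ⟩
      s ^ (s * T) * 2 ^ (3 * W)         ≡⟨ cong (_* 2 ^ (3 * W)) (^-*-assoc 2 σ (s * T)) ⟩
      2 ^ (σ * (s * T)) * 2 ^ (3 * W)   ≡⟨ ^-distribˡ-+-* 2 (σ * (s * T)) (3 * W) ⟨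
      2 ^ (σ * (s * T) + 3 * W)         <⟨ ^-monoʳ-< 2 (s≤s (s≤s z≤n)) exponent-bound ⟩
      2 ^ n                             ∎
      where
      open ≤-Reasoning
      σ = k + 13
      exponent-bound : σ * (s * T) + 3 * W < n
      exponent-bound = begin-strict
        σ * (s * T) + 3 * W               ≡⟨ cong (_+ 3 * W) (regroup σ s) ⟩
        2 * (σ * σ) * s + 3 * W           ≤⟨ +-monoˡ-≤ (3 * W) (*-monoˡ-≤ s (*-monoʳ-≤ 2 σ²≤2^[k+8])) ⟩
        2 * 2 ^ (k + 8) * 2 ^ σ + 3 * W   ≡⟨ cong (_+ 3 * W) (^-distribˡ-+-* 2 (suc (k + 8)) σ) ⟨
        2 ^ (suc (k + 8) + σ) + 3 * W     ≡⟨ cong (λ i → 2 ^ i + 3 * W) (exponent k) ⟩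
        2 ^ (2 + (2 * k + 20)) + 3 * W    ≡⟨ cong (_+ 3 * W) (^-distribˡ-+-* 2 2 (2 * k + 20)) ⟩
        4 * W + 3 * W                     ≡⟨ *-distribʳ-+ W 4 3 ⟨
        7 * W                             <⟨ *-monoˡ-< W {{m^n≢0 2 (2 * k + 20)}} (≤ᵇ⇒≤ 8 16 tt) ⟩
        16 * W                            ≡⟨ ^-distribˡ-+-* 2 4 (2 * k + 20) ⟨
        2 ^ (4 + (2 * k + 20))            ≡⟨ cong (2 ^_) (exponent′ k) ⟩
        n                                 ∎
        where
        σ²≤2^[k+8] = [k+13]²≤2^[k+8] k
        regroup : ∀ σ s → σ * (s * (2 * σ)) ≡ 2 * (σ * σ) * s
        regroup = solve-∀
        exponent : ∀ k → suc (k + 8) + (k + 13) ≡ 2 + (2 * k + 20)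
        exponent = solve-∀
        exponent′ : ∀ k → 4 + (2 * k + 20) ≡ 2 * k + 24
        exponent′ = solve-∀

    ¬¬prime : ¬ ¬ ∃ λ q → q < Q × W < q × Prime q
    ¬¬prime none = <-irrefl refl (begin-strict
      2 ^ n                    ≤⟨ 2^n≤binom[n,n] n ⟩
      binom n n                ≤⟨ m≤n*m (binom n n) N ⟩
      N * binom n n            ≤⟨ ∣⇒≤ {{X≢0}} ([1+a+b]*binom∣ n n ∣X) ⟩
      (s !) ^ T * primorial W  <⟨ s!^T*primorial[W]<2^n ⟩
      2 ^ n                    ∎)
      where
      open ≤-Reasoning
      no-prime : ∀ p → W < p → p ≤ N → ¬ Prime p
      no-prime p W<p p≤N pr = none (p , ≤-<-trans p≤N N<Q , W<p , pr)
      N<s*s : N < s * s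
      N<s*s = subst (N <_) (sym s*s≡Q) N<Q
      N<2^T : N < 2 ^ T
      N<2^T = subst (N <_) (sym 2^T≡Q) N<Q
      ∣X : ∀ i → 0 < i → i ≤ N → i ∣ (s !) ^ T * primorial W
      ∣X = ∣s!^T*primorial {W} {N} {s} {T} no-prime N<s*s N<2^T
      X≢0 : NonZero ((s !) ^ T * primorial W)
      X≢0 = >-nonZero (*-mono-≤ (m^n>0 (s !) {{s !≢0}} T) (primorial>0 W))

  prime-between : ∃ λ q → Prime q × 2 ^ (2 * k + 20) < q × q < 2 ^ (2 * k + 26)
  prime-between =
    case decidable-stable (anyUpTo? (λ q → W <? q ×-dec prime? q) Q) ¬¬prime of λ where
      (q , q<Q , W<q , q-prime) → q , q-prime , W<q , q<Q

-- Non-redundant instances from 4-cycle-free bipartite graphs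

C4Free : ∀ {A B : Set} → (A → B → Set) → Set
C4Free _~_ = ∀ {x x′ y y′} → x ~ y → x ~ y′ → x′ ~ y → x′ ~ y′ →
              x ≡ x′ ⊎ y ≡ y′

grade : ∀ {A B : Set} → Dec A → Dec B → D
grade (yes _) _       = zero
grade (no _)  (yes _) = suc zero
grade (no _)  (no _)  = suc (suc zero)

module _ {n1 n2 n3 : ℕ} {_~_ : Fin n1 → Fin n2 → Set} (_~?_ : Decidable _~_) (c4-free : C4Free _~_)
  where

  -- x′ ↦ 0 if x′ = x, 1 if x′ ~ y, 2 otherwise (dually for y′), and z′ ↦ 0 iff z′ = z.
  -- The only values outside R1 are (1,1,_), a 4-cycle through x and y, and (0,0,0), i.e. e.
  witness : Edge n1 n2 n3 → Assignment n1 n2 n3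
  witness (x , y , z) = (λ x′ → grade (x′ Fin.≟ x) (x′ ~? y))
                      , (λ y′ → grade (y′ Fin.≟ y) (x ~? y′))
                      , (λ z′ → grade (z′ Fin.≟ z) (yes tt))

  witness-others : ∀ {x y z x′ y′ z′} → x ~ y → x′ ~ y′ → (x′ , y′ , z′) ≢ (x , y , z) →
                   R1 (apply (witness (x , y , z)) (x′ , y′ , z′)) ≡ true
  witness-others {x} {y} {z} {x′} {y′} {z′} x~y x′~y′ e′≢e
    with x′ Fin.≟ x | y′ Fin.≟ y | z′ Fin.≟ z | x′ ~? y | x ~? y′
  ... | yes refl | yes refl | yes refl | _         | _         = ⊥-elim (e′≢e refl)
  ... | yes refl | yes refl | no _     | _         | _         = refl
  ... | yes refl | no _     | _        | _         | yes _     = refl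
  ... | yes refl | no _     | _        | _         | no x≁y′   = ⊥-elim (x≁y′ x′~y′)
  ... | no _     | yes refl | _        | yes _     | _         = refl
  ... | no _     | yes refl | _        | no x′≁y   | _         = ⊥-elim (x′≁y x′~y′)
  ... | no x′≢x  | no y′≢y  | _        | yes x′~y  | yes x~y′  =
    ⊥-elim ([ x′≢x ∘ sym , y′≢y ∘ sym ]′ (c4-free x~y x~y′ x′~y x′~y′))
  ... | no _     | no _     | _        | yes _     | no _      = refl
  ... | no _     | no _     | _        | no _      | yes _     = refl
  ... | no _     | no _     | _        | no _      | no _      = refl

  witness-self : ∀ e → S1 (apply (witness e) e) ≡ true × R1 (apply (witness e) e) ≡ false
  witness-self (x , y , z) with x Fin.≟ x | y Fin.≟ y | z Fin.≟ z
  ... | yes _   | yes _   | yes _   = refl , refl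
  ... | no x≢x  | _       | _       = ⊥-elim (x≢x refl)
  ... | yes _   | no y≢y  | _       = ⊥-elim (y≢y refl)
  ... | yes _   | yes _   | no z≢z  = ⊥-elim (z≢z refl)

  C4Free⇒NonRedundant : (E : List (Edge n1 n2 n3)) → All (λ (x , y , _) → x ~ y) E →
                        NonRedundant E
  C4Free⇒NonRedundant E adjacent (x , y , z) e∈E =
    witness (x , y , z) ,
    (λ { (_ , _ , _) e′∈E e′≢e → witness-others (lookup adjacent e∈E) (lookup adjacent e′∈E) e′≢e }) ,
    witness-self (x , y , z)

length-cartesianProductWith : ∀ {A B C : Set} (f : A → B → C) xs ys →
                              length (cartesianProductWith f xs ys) ≡ length xs * length ys
length-cartesianProductWith f []       ys = refl
length-cartesianProductWith f (x ∷ xs) ys =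
  trans (length-++ (map (f x) ys)) (cong₂ _+_ (length-map (f x) ys) (length-cartesianProductWith f xs ys))

length-allFin×allFin : ∀ m n → length (cartesianProduct (allFin m) (allFin n)) ≡ m * n
length-allFin×allFin m n =
  trans (length-cartesianProductWith _,_ (allFin m) (allFin n))
        (cong₂ _*_ (length-tabulate {n = m} id) (length-tabulate {n = n} id))

Unique∧⊆⇒length≤ : ∀ {A : Set} {xs ys : List A} → Unique xs → xs ⊆ ys → length xs ≤ length ys
Unique∧⊆⇒length≤ {xs = []}     _              _  = z≤n
Unique∧⊆⇒length≤ {xs = x ∷ xs} {ys} (x∉xs ∷ u) xs⊆ys with ∈-∃++ (xs⊆ys (here refl))
... | ys₁ , ys₂ , refl =
  ≤-trans (s≤s (Unique∧⊆⇒length≤ u xs⊆ys₁++ys₂)) (≤-reflexive length-split)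
  where
  xs⊆ys₁++ys₂ : xs ⊆ ys₁ ++ ys₂
  xs⊆ys₁++ys₂ {y} y∈xs with ∈-++⁻ ys₁ (xs⊆ys (there y∈xs))
  ... | inj₁ y∈ys₁         = ∈-++⁺ˡ y∈ys₁
  ... | inj₂ (here refl)   = ⊥-elim (lookup x∉xs y∈xs refl)
  ... | inj₂ (there y∈ys₂) = ∈-++⁺ʳ ys₁ y∈ys₂
  length-split : suc (length (ys₁ ++ ys₂)) ≡ length (ys₁ ++ x ∷ ys₂)
  length-split = begin
    suc (length (ys₁ ++ ys₂))          ≡⟨ cong suc (length-++ ys₁) ⟩
    suc (length ys₁ + length ys₂)      ≡⟨ +-suc (length ys₁) (length ys₂) ⟨
    length ys₁ + length (x ∷ ys₂)      ≡⟨ length-++ ys₁ ⟨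
    length (ys₁ ++ x ∷ ys₂)            ∎
    where open ≡-Reasoning

projSize≤ : ∀ {n1 n2 n3} {A : Set} I (E : List (Edge n1 n2 n3))
            (φ : Edge n1 n2 n3 → A) (f : A → List ℕ) (G : List A) →
            (∀ e → proj I e ≡ f (φ e)) → All (λ e → φ e ∈ G) E → projSize I E ≤ length G
projSize≤ I E φ f G proj≡f∘φ φ∈G = begin
  projSize I E     ≤⟨ Unique∧⊆⇒length≤ (deduplicate-! (map (proj I) E)) ⊆map-f ⟩
  length (map f G) ≡⟨ length-map f G ⟩
  length G         ∎
  where
  open ≤-Reasoning
  ⊆map-f : deduplicate (LP.≡-dec _≟_) (map (proj I) E) ⊆ map f G
  ⊆map-f v∈ with ∈-map⁻ (proj I) (∈-deduplicate⁻ (LP.≡-dec _≟_) (map (proj I) E) v∈)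
  ... | e , e∈E , refl = subst (_∈ map f G) (sym (proj≡f∘φ e)) (∈-map⁺ f (lookup φ∈G e∈E))

projSize-x-free : ∀ {n1 n2 n3} I (E : List (Edge n1 n2 n3)) → I zero ≡ false → projSize I E ≤ n2 * n3
projSize-x-free {n1} {n2} {n3} I E I₀≡false =
  ≤-trans (projSize≤ I E φ f (cartesianProduct (allFin n2) (allFin n3)) proj≡f∘φ (All.tabulate φ∈))
          (≤-reflexive (length-allFin×allFin n2 n3))
  where
  φ : Edge n1 n2 n3 → Fin n2 × Fin n3
  φ (_ , y , z) = y , z
  f : Fin n2 × Fin n3 → List ℕ
  f (y , z) = keep (I (suc zero)) (toℕ y) (keep (I (suc (suc zero))) (toℕ z) [])
  proj≡f∘φ : ∀ e → proj I e ≡ f (φ e)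
  proj≡f∘φ (x , y , z) rewrite I₀≡false = refl
  φ∈ : ∀ {e} → e ∈ E → φ e ∈ cartesianProduct (allFin n2) (allFin n3)
  φ∈ {_ , y , z} _ = ∈-cartesianProduct⁺ (∈-allFin y) (∈-allFin z)

projSize-y-free : ∀ {n1 n2 n3} I (E : List (Edge n1 n2 n3)) → I (suc zero) ≡ false → projSize I E ≤ n1 * n3
projSize-y-free {n1} {n2} {n3} I E I₁≡false =
  ≤-trans (projSize≤ I E φ f (cartesianProduct (allFin n1) (allFin n3)) proj≡f∘φ (All.tabulate φ∈))
          (≤-reflexive (length-allFin×allFin n1 n3))
  where
  φ : Edge n1 n2 n3 → Fin n1 × Fin n3
  φ (x , _ , z) = x , z
  f : Fin n1 × Fin n3 → List ℕ
  f (x , z) = keep (I zero) (toℕ x) (keep (I (suc (suc zero))) (toℕ z) [])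
  proj≡f∘φ : ∀ e → proj I e ≡ f (φ e)
  proj≡f∘φ (x , y , z) rewrite I₁≡false = refl
  φ∈ : ∀ {e} → e ∈ E → φ e ∈ cartesianProduct (allFin n1) (allFin n3)
  φ∈ {x , _ , z} _ = ∈-cartesianProduct⁺ (∈-allFin x) (∈-allFin z)

projSize-z-free : ∀ {n1 n2 n3} I (E : List (Edge n1 n2 n3)) (G : List (Fin n1 × Fin n2)) →
                  I (suc (suc zero)) ≡ false → All (λ (x , y , _) → (x , y) ∈ G) E → projSize I E ≤ length G
projSize-z-free {n1} {n2} {n3} I E G I₂≡false = projSize≤ I E φ f G proj≡f∘φ
  where
  φ : Edge n1 n2 n3 → Fin n1 × Fin n2
  φ (x , y , _) = x , y
  f : Fin n1 × Fin n2 → List ℕ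
  f (x , y) = keep (I zero) (toℕ x) (keep (I (suc zero)) (toℕ y) [])
  proj≡f∘φ : ∀ e → proj I e ≡ f (φ e)
  proj≡f∘φ (x , y , z) rewrite I₂≡false = refl

thicken : ∀ {n1 n2} n3 → List (Fin n1 × Fin n2) → List (Edge n1 n2 n3)
thicken n3 G = cartesianProductWith (λ (x , y) z → x , y , z) G (allFin n3)

length-thicken : ∀ {n1 n2} n3 (G : List (Fin n1 × Fin n2)) → length (thicken n3 G) ≡ length G * n3
length-thicken n3 G =
  trans (length-cartesianProductWith _ G (allFin n3)) (cong (length G *_) (length-tabulate id))

Unique-thicken : ∀ {n1 n2} n3 {G : List (Fin n1 × Fin n2)} → Unique G → Unique (thicken n3 G)
Unique-thicken n3 unique = cartesianProductWith⁺ _ (λ { refl → refl , refl }) unique (allFin⁺ n3)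

thicken⊆G : ∀ {n1 n2} n3 (G : List (Fin n1 × Fin n2)) → All (λ (x , y , _) → (x , y) ∈ G) (thicken n3 G)
thicken⊆G n3 G = All.tabulate λ e∈ →
  case ∈-cartesianProductWith⁻ _ G (allFin n3) e∈ of λ where
    (_ , _ , xy∈G , _ , refl) → xy∈G

ShrinkingInstance : ℕ → ℕ → Set
ShrinkingInstance K m =
  Σ ℕ λ n1 → Σ ℕ λ n2 → Σ ℕ λ n3 → Σ (List (Edge n1 n2 n3)) λ E →
    Unique E × length E ≡ m × NonRedundant E × (∀ I → Proper I → projSize I E ^ 4 ≤ K * m ^ 3)

-- The affine plane over ℤ/qℤ

remQuot-injective : ∀ {n} k {i j : Fin (n * k)} → remQuot {n} k i ≡ remQuot k j → i ≡ j
remQuot-injective {n} k {i} {j} eq =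
  trans (sym (combine-remQuot {n} k i)) (trans (cong (uncurry combine) eq) (combine-remQuot {n} k j))

q^3≡q*q*q : ∀ q → q ^ 3 ≡ q * (q * q)
q^3≡q*q*q q = cong (λ t → q * (q * t)) (*-identityʳ q)

q^4≡q*q*q*q : ∀ q → q ^ 4 ≡ q * (q * (q * q))
q^4≡q*q*q*q q = cong (q *_) (q^3≡q*q*q q)

module _ {q : ℕ} .{{_ : NonZero q}} where

  [m+n]%q≡m%q⇒q∣n : ∀ m n → (m + n) % q ≡ m % q → q ∣ n
  [m+n]%q≡m%q⇒q∣n m n eq = ∣m+n∣m⇒∣n (divides ((m + n) / q) (+-cancelˡ-≡ (m % q) _ _ (begin
    m % q + (m / q * q + n)       ≡⟨ +-assoc (m % q) (m / q * q) n ⟨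
    m % q + m / q * q + n         ≡⟨ cong (_+ n) (m≡m%n+[m/n]*n m q) ⟨
    m + n                         ≡⟨ m≡m%n+[m/n]*n (m + n) q ⟩
    (m + n) % q + (m + n) / q * q ≡⟨ cong (_+ (m + n) / q * q) eq ⟩
    m % q + (m + n) / q * q       ∎))) (n∣m*n (m / q))
    where open ≡-Reasoning

  ∣∧<⇒≡0 : ∀ {d} → q ∣ d → d < q → d ≡ 0
  ∣∧<⇒≡0 {zero}  _   _   = refl
  ∣∧<⇒≡0 {suc d} q∣d d<q = ⊥-elim (<⇒≱ d<q (∣⇒≤ q∣d))

  q∣n⇒m+n≡m : ∀ {m n} → m + n < q → q ∣ n → m + n ≡ m
  q∣n⇒m+n≡m {m} {n} m+n<q q∣n =
    trans (cong (m +_) (∣∧<⇒≡0 q∣n (≤-<-trans (m≤n+m n m) m+n<q))) (+-identityʳ m)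

  +-%-cancel-≤ : ∀ m {c c′} → c ≤ c′ → c′ < q → (m + c) % q ≡ (m + c′) % q → c ≡ c′
  +-%-cancel-≤ m {c} c≤c′ c′<q eq with m≤n⇒∃[o]m+o≡n c≤c′
  ... | d , refl =
    sym (q∣n⇒m+n≡m c′<q ([m+n]%q≡m%q⇒q∣n (m + c) d (trans (cong (_% q) (+-assoc m c d)) (sym eq))))

  +-%-cancelˡ : ∀ m {c c′} → c < q → c′ < q → (m + c) % q ≡ (m + c′) % q → c ≡ c′
  +-%-cancelˡ m {c} {c′} c<q c′<q eq with ≤-total c c′
  ... | inj₁ c≤c′ = +-%-cancel-≤ m c≤c′ c′<q eq
  ... | inj₂ c′≤c = sym (+-%-cancel-≤ m c′≤c c<q (sym eq))

module AffinePlane {q : ℕ} (q-prime : Prime q) where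

  private instance
    q≢0 : NonZero q
    q≢0 = prime⇒nonZero q-prime

  cross-≤ : ∀ {μ μ′ a a′} z → μ′ ≤ μ → a′ ≤ a → μ < q → a < q →
            (μ * a + μ′ * a′ + z) % q ≡ (μ′ * a + μ * a′ + z) % q → μ ≡ μ′ ⊎ a ≡ a′
  cross-≤ {μ′ = μ′} {a′ = a′} z μ′≤μ a′≤a μ<q a<q eq
    with m≤n⇒∃[o]m+o≡n μ′≤μ | m≤n⇒∃[o]m+o≡n a′≤a
  ... | d , refl | e , refl = Sum.map (q∣n⇒m+n≡m μ<q) (q∣n⇒m+n≡m a<q) (euclidsLemma d e q-prime q∣de)
    where
    expand : ∀ μ′ d a′ e z → (μ′ + d) * (a′ + e) + μ′ * a′ + z
                           ≡ μ′ * (a′ + e) + (μ′ + d) * a′ + z + d * e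
    expand = solve-∀
    q∣de : q ∣ d * e
    q∣de = [m+n]%q≡m%q⇒q∣n (μ′ * (a′ + e) + (μ′ + d) * a′ + z) (d * e)
                           (trans (cong (_% q) (sym (expand μ′ d a′ e z))) eq)

  swap-summands : ∀ x y u v z → (x + y + z) % q ≡ (u + v + z) % q →
                  (y + x + z) % q ≡ (v + u + z) % q
  swap-summands x y u v z = subst₂ (λ s t → (s + z) % q ≡ (t + z) % q) (+-comm x y) (+-comm u v)

  -- (μ − μ′) (a − a′) ≡ 0 (mod q), written without subtraction.
  cross : ∀ {μ μ′ a a′} z → μ < q → μ′ < q → a < q → a′ < q →
          (μ * a + μ′ * a′ + z) % q ≡ (μ′ * a + μ * a′ + z) % q → μ ≡ μ′ ⊎ a ≡ a′
  cross {μ} {μ′} {a} {a′} z μ<q μ′<q a<q a′<q eq with ≤-total μ′ μ | ≤-total a′ a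
  ... | inj₁ μ′≤μ | inj₁ a′≤a = cross-≤ z μ′≤μ a′≤a μ<q a<q eq
  ... | inj₂ μ≤μ′ | inj₁ a′≤a = Sum.map₁ sym (cross-≤ z μ≤μ′ a′≤a μ′<q a<q (sym eq))
  ... | inj₁ μ′≤μ | inj₂ a≤a′ = Sum.map₂ sym (cross-≤ z μ′≤μ a≤a′ μ<q a′<q
                                   (swap-summands (μ′ * a) (μ * a′) (μ * a) (μ′ * a′) z (sym eq)))
  ... | inj₂ μ≤μ′ | inj₂ a≤a′ = Sum.map sym sym (cross-≤ z μ≤μ′ a≤a′ μ′<q a′<q
                                   (swap-summands (μ * a) (μ′ * a′) (μ′ * a) (μ * a′) z eq))

  Incident : Fin q × Fin q → Fin q × Fin q → Set
  Incident (a , b) (μ , c) = toℕ b ≡ (toℕ μ * toℕ a + toℕ c) % q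

  Incident? : Decidable Incident
  Incident? (a , b) (μ , c) = toℕ b ≟ (toℕ μ * toℕ a + toℕ c) % q

  Incident-C4Free : C4Free Incident
  Incident-C4Free {a , b} {a′ , b′} {μ , c} {μ′ , c′} b≡μa+c b≡μ′a+c′ b′≡μa′+c b′≡μ′a′+c′
    with cross (C + C′) (toℕ<n μ) (toℕ<n μ′) (toℕ<n a) (toℕ<n a′) cross-sum
    where
    A = toℕ a ; A′ = toℕ a′ ; M = toℕ μ ; M′ = toℕ μ′ ; C = toℕ c ; C′ = toℕ c′
    cross-sum : (M * A + M′ * A′ + (C + C′)) % q ≡ (M′ * A + M * A′ + (C + C′)) % q
    cross-sum = begin
      (M * A + M′ * A′ + (C + C′)) % q            ≡⟨ cong (_% q) (shuffle (M * A) (M′ * A′) C C′) ⟩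
      ((M * A + C) + (M′ * A′ + C′)) % q          ≡⟨ %-distribˡ-+ (M * A + C) (M′ * A′ + C′) q ⟩
      ((M * A + C) % q + (M′ * A′ + C′) % q) % q  ≡⟨ cong₂ (λ s t → (s + t) % q)
                                                       (trans (sym b≡μa+c) b≡μ′a+c′)
                                                       (trans (sym b′≡μ′a′+c′) b′≡μa′+c) ⟩
      ((M′ * A + C′) % q + (M * A′ + C) % q) % q  ≡⟨ %-distribˡ-+ (M′ * A + C′) (M * A′ + C) q ⟨
      ((M′ * A + C′) + (M * A′ + C)) % q          ≡⟨ cong (_% q) (shuffle′ (M′ * A) (M * A′) C′ C) ⟩
      (M′ * A + M * A′ + (C + C′)) % q            ∎
      where
      open ≡-Reasoning
      shuffle : ∀ x y c c′ → x + y + (c + c′) ≡ (x + c) + (y + c′)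
      shuffle = solve-∀
      shuffle′ : ∀ x y c′ c → (x + c′) + (y + c) ≡ x + y + (c + c′)
      shuffle′ = solve-∀
  ... | inj₁ M≡M′ = inj₂ (cong₂ _,_ (toℕ-injective M≡M′) (toℕ-injective C≡C′))
    where
    C≡C′ : toℕ c ≡ toℕ c′
    C≡C′ = +-%-cancelˡ (toℕ μ * toℕ a) (toℕ<n c) (toℕ<n c′)
             (trans (sym b≡μa+c) (trans b≡μ′a+c′ (cong (λ m → (m * toℕ a + toℕ c′) % q) (sym M≡M′))))
  ... | inj₂ A≡A′ = inj₁ (cong₂ _,_ (toℕ-injective A≡A′) (toℕ-injective B≡B′))
    where
    B≡B′ : toℕ b ≡ toℕ b′
    B≡B′ = trans b≡μa+c (trans (cong (λ n → (toℕ μ * n + toℕ c) % q) A≡A′) (sym b′≡μa′+c))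

  coords : Fin (q * q) → Fin q × Fin q
  coords = remQuot {q} q

  _on_ : Fin (q * q) → Fin (q * q) → Set
  x on ℓ = Incident (coords x) (coords ℓ)

  _on?_ : Decidable _on_
  x on? ℓ = Incident? (coords x) (coords ℓ)

  on-C4Free : C4Free _on_
  on-C4Free x∈ℓ x∈ℓ′ x′∈ℓ x′∈ℓ′ =
    Sum.map (remQuot-injective {q} q) (remQuot-injective {q} q)
            (Incident-C4Free x∈ℓ x∈ℓ′ x′∈ℓ x′∈ℓ′)

  pointOn : Fin q × Fin q → Fin q → Fin (q * q)
  pointOn (μ , c) a = combine a ((toℕ μ * toℕ a + toℕ c) mod q)

  pointOn-on : ∀ a ℓ → pointOn (coords ℓ) a on ℓ
  pointOn-on a ℓ =
    subst (λ x → Incident x (coords ℓ)) (sym (remQuot-combine {q} {q} a _)) (toℕ-fromℕ< _)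

  flag : Fin q → Fin (q * q) → Fin (q * q) × Fin (q * q)
  flag a ℓ = pointOn (coords ℓ) a , ℓ

  flag-injective : ∀ {a a′ ℓ ℓ′} → flag a ℓ ≡ flag a′ ℓ′ → a ≡ a′ × ℓ ≡ ℓ′
  flag-injective {a} {a′} eq with cong proj₂ eq
  ... | refl = combine-injectiveˡ a _ a′ _ (cong proj₁ eq) , refl

  flags : List (Fin (q * q) × Fin (q * q))
  flags = cartesianProductWith flag (allFin q) (allFin (q * q))

  flags-on : All (λ (x , ℓ) → x on ℓ) flags
  flags-on = All.tabulate λ xℓ∈ →
    case ∈-cartesianProductWith⁻ flag (allFin q) (allFin (q * q)) xℓ∈ of λ where
      (a , ℓ , _ , _ , refl) → pointOn-on a ℓ

  length-flags : length flags ≡ q * (q * q)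
  length-flags = trans (length-cartesianProductWith flag (allFin q) (allFin (q * q)))
                       (cong₂ _*_ (length-tabulate {n = q} id) (length-tabulate {n = q * q} id))

  shrinking-instance : ∀ m → m ≤ q ^ 4 → ∀ {K} → (q ^ 3) ^ 4 ≤ K * m ^ 3 → ShrinkingInstance K m
  shrinking-instance m m≤q⁴ q¹²≤Km³ =
    q * q , q * q , q , E ,
    take⁺ m (Unique-thicken q (cartesianProductWith⁺ flag flag-injective (allFin⁺ q) (allFin⁺ (q * q)))) ,
    length-E ,
    C4Free⇒NonRedundant _on?_ on-C4Free E (All.take⁺ m (All.map (lookup flags-on) (thicken⊆G q flags))) ,
    λ I proper → ≤-trans (^-monoˡ-≤ 4 (projSize≤q³ I proper)) q¹²≤Km³
    where
    E = take m (thicken q flags)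
    length-full : length (thicken q flags) ≡ q * (q * (q * q))
    length-full = trans (length-thicken q flags) (trans (cong (_* q) length-flags) (*-comm (q * (q * q)) q))
    length-E : length E ≡ m
    length-E = trans (length-take m (thicken q flags))
                     (m≤n⇒m⊓n≡m (≤-trans m≤q⁴ (≤-reflexive (trans (q^4≡q*q*q*q q) (sym length-full)))))
    projSize≤q³ : ∀ I → Proper I → projSize I E ≤ q ^ 3
    projSize≤q³ I (zero , I₀≡false) =
      ≤-trans (projSize-x-free I E I₀≡false) (≤-reflexive (trans (*-comm (q * q) q) (sym (q^3≡q*q*q q))))
    projSize≤q³ I (suc zero , I₁≡false) =
      ≤-trans (projSize-y-free I E I₁≡false) (≤-reflexive (trans (*-comm (q * q) q) (sym (q^3≡q*q*q q))))
    projSize≤q³ I (suc (suc zero) , I₂≡false) =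
      ≤-trans (projSize-z-free I E flags I₂≡false (All.take⁺ m (thicken⊆G q flags)))
              (≤-reflexive (trans length-flags (sym (q^3≡q*q*q q))))

-- Choosing q for a given m

n<b^n : ∀ {b} → 1 < b → ∀ n → n < b ^ n
n<b^n 1<b zero        = s≤s z≤n
n<b^n {b} 1<b (suc n) = begin-strict
  suc n      ≤⟨ n<b^n 1<b n ⟩
  b ^ n      <⟨ m<m*n (b ^ n) b {{m^n≢0 b n {{>-nonZero (<⇒≤ 1<b)}}}} 1<b ⟩
  b ^ n * b  ≡⟨ *-comm (b ^ n) b ⟩
  b * b ^ n  ∎
  where open ≤-Reasoning

between-powers : ∀ {b} j {m} → 1 < b → b ^ j < m → ∃ λ k → b ^ (k + j) < m × m ≤ b ^ (k + suc j)
between-powers {b} j {m} 1<b b^j<m = search m m≤b^[m+j]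
  where
  m≤b^[m+j] : m ≤ b ^ (m + j)
  m≤b^[m+j] = ≤-trans (<⇒≤ (n<b^n 1<b m)) (^-monoʳ-≤ b {{>-nonZero (<⇒≤ 1<b)}} (m≤m+n m j))
  search : ∀ f → m ≤ b ^ (f + j) → ∃ λ k → b ^ (k + j) < m × m ≤ b ^ (k + suc j)
  search zero    m≤b^j          = ⊥-elim (<⇒≱ b^j<m m≤b^j)
  search (suc f) m≤b^[1+f+j] with m ≤? b ^ (f + j)
  ... | yes m≤b^[f+j] = search f m≤b^[f+j]
  ... | no  m≰b^[f+j] = f , ≰⇒> m≰b^[f+j] , subst (λ i → m ≤ b ^ i) (sym (+-suc f j)) m≤b^[1+f+j]

m≤q^4 : ∀ k {m q} → m ≤ (2 ^ 8) ^ (k + 10) → 2 ^ (2 * k + 20) < q → m ≤ q ^ 4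
m≤q^4 k {m} {q} upper lower = begin
  m                          ≤⟨ upper ⟩
  (2 ^ 8) ^ (k + 10)         ≡⟨ ^-*-assoc 2 8 (k + 10) ⟩
  2 ^ (8 * (k + 10))         ≡⟨ cong (2 ^_) (exponent k) ⟩
  2 ^ ((2 * k + 20) * 4)     ≡⟨ ^-*-assoc 2 (2 * k + 20) 4 ⟨
  (2 ^ (2 * k + 20)) ^ 4     ≤⟨ ^-monoˡ-≤ 4 (<⇒≤ lower) ⟩
  q ^ 4                      ∎
  where
  open ≤-Reasoning
  exponent : ∀ k → 8 * (k + 10) ≡ (2 * k + 20) * 4
  exponent = solve-∀

[q^3]^4≤K*m^3 : ∀ {K u Q m q} → (Q ^ 3) ^ 4 ≡ K * u ^ 3 → u < m → q < Q → (q ^ 3) ^ 4 ≤ K * m ^ 3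
[q^3]^4≤K*m^3 {K} {u} {Q} {m} {q} Q¹²≡Ku³ u<m q<Q = begin
  (q ^ 3) ^ 4    ≤⟨ ^-monoˡ-≤ 4 (^-monoˡ-≤ 3 (<⇒≤ q<Q)) ⟩
  (Q ^ 3) ^ 4    ≡⟨ Q¹²≡Ku³ ⟩
  K * u ^ 3      ≤⟨ *-monoʳ-≤ K (^-monoˡ-≤ 3 (<⇒≤ u<m)) ⟩
  K * m ^ 3      ∎
  where open ≤-Reasoning

-- For a literal base, b ^ 96 * x would unfold into b ^ 96 additions whenever Agda compares it
-- with a term that is not syntactically equal; keeping b abstract avoids this.
twelfth-power-split : ∀ b k → ((b ^ (2 * k + 26)) ^ 3) ^ 4 ≡ b ^ 96 * ((b ^ 8) ^ (k + 9)) ^ 3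
twelfth-power-split b k = begin
  ((b ^ (2 * k + 26)) ^ 3) ^ 4       ≡⟨ cong (_^ 4) (^-*-assoc b (2 * k + 26) 3) ⟩
  (b ^ ((2 * k + 26) * 3)) ^ 4       ≡⟨ ^-*-assoc b ((2 * k + 26) * 3) 4 ⟩
  b ^ ((2 * k + 26) * 3 * 4)         ≡⟨ cong (b ^_) (exponent k) ⟩
  b ^ (8 * (k + 9) * 3 + 96)         ≡⟨ ^-distribˡ-+-* b (8 * (k + 9) * 3) 96 ⟩
  b ^ (8 * (k + 9) * 3) * b ^ 96     ≡⟨ *-comm (b ^ (8 * (k + 9) * 3)) (b ^ 96) ⟩
  b ^ 96 * b ^ (8 * (k + 9) * 3)     ≡⟨ cong (b ^ 96 *_) (^-*-assoc b (8 * (k + 9)) 3) ⟨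
  b ^ 96 * (b ^ (8 * (k + 9))) ^ 3   ≡⟨ cong (λ x → b ^ 96 * x ^ 3) (^-*-assoc b 8 (k + 9)) ⟨
  b ^ 96 * ((b ^ 8) ^ (k + 9)) ^ 3   ∎
  where
  open ≡-Reasoning
  exponent : ∀ k → (2 * k + 26) * 3 * 4 ≡ 8 * (k + 9) * 3 + 96
  exponent = solve-∀

-- Pattern-matching lambdas rather than with-clauses, which normalise the goal 2 ^ 96 * m ^ 3.
lemma4p4 : ∃ λ (K : ℕ) → ∃ λ (M : ℕ) → ∀ (m : ℕ) → M ≤ m →
    Σ ℕ λ n1 → Σ ℕ λ n2 → Σ ℕ λ n3 → Σ (List (Edge n1 n2 n3)) λ E →
    Unique E × length E ≡ m × NonRedundant E ×
    (∀ (I : Subset3) → Proper I → projSize I E ^ 4 ≤ K * m ^ 3)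
lemma4p4 = 2 ^ 96 , suc ((2 ^ 8) ^ 9) , λ m 2^72<m →
  case between-powers {2 ^ 8} 9 (≤ᵇ⇒≤ 2 256 tt) 2^72<m of λ where
    (k , 2^[8k+72]<m , m≤2^[8k+80]) → case prime-between k of λ where
      (q , q-prime , 2^[2k+20]<q , q<2^[2k+26]) →
        AffinePlane.shrinking-instance q-prime m (m≤q^4 k m≤2^[8k+80] 2^[2k+20]<q) {K = 2 ^ 96}
          ([q^3]^4≤K*m^3 {K = 2 ^ 96} (twelfth-power-split 2 k) 2^[8k+72]<m q<2^[2k+26])
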